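{- Let $k\geq 3$, $n\geq 1$, and $i\in\{0,\ldots,k-1\}$. If $g\in G(H_n^k)$ satisfies $g(\overline{i_n})=\overline{i_n}$, then $g(v)\in[i]$ for all $v\in[i]$; that is, $g([i])=[i]$ as a set.
   Context: The Tower of Hanoi puzzle has $k$ pegs labeled $0,\ldots,k-1$ and $n$ disks labeled $0,\ldots,n-1$ by increasing size. A state is encoded by the string $a_{n-1}\cdots a_0$ with $a_i\in\{0,\ldots,k-1\}$ meaning disk $i$ lies on peg $a_i$. The graph $H_n^k$ has these $k^n$ strings as vertices, with a single edge between two vertices iff one is obtained from the other by one legal move (moving the smallest disk of some peg onto another peg that is empty or whose smallest disk is larger). $G(H_n^k)$ is the group of adjacency-preserving bijections of $V(H_n^k)$. $\overline{i_n}$ denotes the string $ii\cdots i$ of length $n$. The substructure $[i]$ is the set of vertices with $a_{n-1}=i$. -}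

module Defs where

open import Data.Nat using (ℕ; suc)
open import Data.Fin using (Fin; toℕ; fromℕ; _<_)
open import Data.Product using (Σ; _×_; _,_)
open import Relation.Binary.PropositionalEquality using (_≡_; _≢_)
open import Relation.Nullary using (¬_)
open import Function.Bundles using (_↔_; Inverse)
open import Level using (0ℓ)

-- A state of H_n^k: disk d (0 = smallest, n-1 = largest) lies on peg (s d).
-- This is the string a_{n-1} ... a_0 with a_d = s d.
State : ℕ → ℕ → Set
State k n = Fin n → Fin k

-- One legal move takes s to t: exactly one disk d changes peg, from s d to t d,
-- and d is the smallest disk on peg s d (no smaller disk lies on s d) and
-- smaller than every disk on peg t d (no smaller disk lies on t d).
-- (Smaller disks are on the same pegs in s and t, since only d moves.)
Move : ∀ {k n} → State k n → State k n → Set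
Move {k} {n} s t =
  Σ (Fin n) λ d →
      (s d ≢ t d)
    × (∀ e → e ≢ d → s e ≡ t e)
    × (∀ e → e < d → s e ≢ s d)
    × (∀ e → e < d → s e ≢ t d)

-- Adjacency in H_n^k (moves are reversible, so this is symmetric anyway).
Adj : ∀ {k n} → State k n → State k n → Set
Adj s t = Move s t

record Aut (k n : ℕ) : Set where
  field
    bij  : State k n ↔ State k n
    adj-iff : ∀ u v → (Adj u v → Adj (Inverse.to bij u) (Inverse.to bij v))
                    × (Adj (Inverse.to bij u) (Inverse.to bij v) → Adj u v)

  to : State k n → State k n
  to = Inverse.to bij

const : ∀ {k n} → Fin k → State k n
const i _ = i

-- Substructure [i] for n = suc m: the largest disk (disk m) lies on peg i.
InSub : ∀ {k m} → Fin k → State k (suc m) → Set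
InSub {m = m} i v = v (fromℕ m) ≡ i

module Submission where

-- For r ≤ n call two states r-equivalent when they agree on the disks
-- r, r+1, …, n-1.  The r-classes are the copies of H_r^k inside H_n^k, and
-- contracting them gives a copy of H_{n-r}^k.  We prove by induction on r that
-- EVERY automorphism maps r-equivalent states to r-equivalent states:
--   * r = 0: a state is determined by its neighbourhood;
--   * r → r+1: two (r+1)-equivalent states are either r-equivalent, or their
--     r-classes differ only in the peg of disk r.  In the latter case the two
--     classes are "twins": adjacent, and part of a k-clique of r-classes.
--     Conversely twin classes differ only in disk r: if a larger disk d moved,
--     each further clique member must put d on a peg other than the source and
--     target of d and the peg of disk r, leaving k-3 pegs for k-2 members.
--     Twins are defined by adjacency of classes, so automorphisms that respect
--     r-classes preserve them, and hence respect (r+1)-classes.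
-- For r = n-1 the classes are the substructures [j]; since g fixes ī ∈ [i],
-- g maps [i] into [i].

open import Defs
open import Data.Nat using (ℕ; suc; _≤_)
open import Data.Fin using (Fin)
open import Relation.Binary.PropositionalEquality using (_≡_)

open import Data.Nat using (_+_; zero; z≤n; s≤s; _<_; _<?_; _≤?_)
open import Data.Nat.Properties
  using (≤-refl; n<1+n; <-irrefl; <⇒≤; ≤∧≢⇒<; ≮⇒≥; m≤n⇒m<n∨m≡n; <-≤-trans)
open import Data.Fin using (zero; toℕ; fromℕ; fromℕ<; punchIn; punchOut; _≟_)
open import Data.Fin.Properties
  using (toℕ-injective; toℕ<n; toℕ-fromℕ; toℕ-fromℕ<; ≤fromℕ; ≤-antisym; punchInᵢ≢i;
         punchIn-injective; punchOut-injective; punchIn-punchOut; <⇒notInjective)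
open import Data.Vec.Functional using (updateAt)
open import Data.Vec.Functional.Properties using (updateAt-updates; updateAt-minimal)
open import Data.Product using (Σ; _×_; _,_; proj₁; proj₂)
open import Data.Sum using (_⊎_; inj₁; inj₂)
open import Data.Empty using (⊥; ⊥-elim)
open import Relation.Nullary using (¬_; Dec; yes; no)
open import Relation.Binary.PropositionalEquality
  using (_≢_; refl; sym; trans; cong; subst; subst₂)
open import Function using (_∘_)
open import Function.Bundles using (Inverse)
open import Function.Definitions using (Injective)
open import Function.Properties.Inverse using (↔-sym)

thirdPeg : ∀ {k} (α β : Fin (3 + k)) → Σ (Fin (3 + k)) λ γ → γ ≢ α × γ ≢ β
thirdPeg α β with α ≟ β
... | yes refl = punchIn α zero , punchInᵢ≢i α zero , punchInᵢ≢i α zero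
... | no α≢β =
  punchIn α (punchIn (punchOut α≢β) zero) , punchInᵢ≢i α _ ,
  λ eq → punchInᵢ≢i (punchOut α≢β) zero
           (punchIn-injective α _ _ (trans eq (sym (punchIn-punchOut α≢β))))

Misses : ∀ {a b} → Fin b → (Fin a → Fin b) → Set
Misses α f = ∀ x → α ≢ f x

dropMissed : ∀ {a b} {α : Fin (suc b)} {f : Fin a → Fin (suc b)} →
             Misses α f → Fin a → Fin b
dropMissed α∉f x = punchOut (α∉f x)

dropMissed-injective : ∀ {a b} {α : Fin (suc b)} {f : Fin a → Fin (suc b)}
  (α∉f : Misses α f) → Injective _≡_ _≡_ f → Injective _≡_ _≡_ (dropMissed α∉f)
dropMissed-injective α∉f inj {x} {y} eq = inj (punchOut-injective (α∉f x) (α∉f y) eq)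

dropMissed-misses : ∀ {a b} {α β : Fin (suc b)} {f : Fin a → Fin (suc b)}
  (α∉f : Misses α f) (α≢β : α ≢ β) → Misses β f → Misses (punchOut α≢β) (dropMissed α∉f)
dropMissed-misses α∉f α≢β β∉f x = β∉f x ∘ punchOut-injective α≢β (α∉f x)

noInjectionMissingThree : ∀ {j} {f : Fin (suc j) → Fin (3 + j)} → Injective _≡_ _≡_ f →
  ∀ {α β γ} → Misses α f → Misses β f → Misses γ f → α ≢ β → α ≢ γ → β ≢ γ → ⊥
noInjectionMissingThree {j} inj α∉f β∉f γ∉f α≢β α≢γ β≢γ =
  <⇒notInjective (n<1+n j)
    (dropMissed-injective γ∉f₂ (dropMissed-injective β∉f₁ (dropMissed-injective α∉f inj)))
  where
    β∉f₁ = dropMissed-misses α∉f α≢β β∉f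
    γ∉f₂ = dropMissed-misses β∉f₁ (β≢γ ∘ punchOut-injective α≢β α≢γ)
                                   (dropMissed-misses α∉f α≢γ γ∉f)

inverse : ∀ {k n} → Aut k n → Aut k n
inverse g = record
  { bij = ↔-sym (Aut.bij g)
  ; adj-iff = λ u v →
      (λ a → proj₂ (Aut.adj-iff g (from u) (from v))
               (subst₂ Adj (sym (to∘from u)) (sym (to∘from v)) a)) ,
      (λ a → subst₂ Adj (to∘from u) (to∘from v)
               (proj₁ (Aut.adj-iff g (from u) (from v)) a))
  }
  where
    from = Inverse.from (Aut.bij g)
    to∘from = Inverse.strictlyInverseˡ (Aut.bij g)

Adj-irrefl : ∀ {k n} {s : State k n} → ¬ Adj s s
Adj-irrefl (_ , moved , _) = moved refl

Adj-respˡ : ∀ {k n} {s s′ t : State k n} → (∀ d → s d ≡ s′ d) → Adj s t → Adj s′ t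
Adj-respˡ s≗s′ (d , moved , fixed , clear-s , clear-t) =
  d , moved ∘ trans (s≗s′ d) , (λ e e≢d → trans (sym (s≗s′ e)) (fixed e e≢d)) ,
  (λ e e<d eq → clear-s e e<d (trans (s≗s′ e) (trans eq (sym (s≗s′ d))))) ,
  (λ e e<d eq → clear-t e e<d (trans (s≗s′ e) eq))

module Contraction (k m : ℕ) where

  K : ℕ
  K = 3 + k

  N : ℕ
  N = suc m

  S : Set
  S = State K N

  place : Fin N → Fin K → S → S
  place d α s = updateAt s d (λ _ → α)

  moveSmallest : ∀ {s t : S} → s zero ≢ t zero → (∀ e → e ≢ zero → s e ≡ t e) → Adj s t
  moveSmallest s₀≢t₀ fixed = zero , s₀≢t₀ , fixed , (λ _ ()) , (λ _ ())

  -- A state is determined by its neighbourhood: move disk 0 of s to a peg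
  -- avoiding s 0 and t 0; the result is a neighbour of t only if t agrees with
  -- s off disk 0, and then t must also agree on disk 0, else t ~ t.
  neighbourhood-determines : ∀ s t → (∀ x → Adj s x → Adj t x) → ∀ d → s d ≡ t d
  neighbourhood-determines s t nbr = agree
    where
      γ = thirdPeg (s zero) (t zero)
      x = place zero (proj₁ γ) s
      x₀ : x zero ≡ proj₁ γ
      x₀ = updateAt-updates zero {f = λ _ → proj₁ γ} s
      x-off : ∀ e → e ≢ zero → x e ≡ s e
      x-off e e≢0 = updateAt-minimal e zero s e≢0
      s~x : Adj s x
      s~x = moveSmallest (λ eq → proj₁ (proj₂ γ) (sym (trans eq x₀)))
                         (λ e e≢0 → sym (x-off e e≢0))
      agree-off-zero : ∀ e → e ≢ zero → s e ≡ t e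
      agree-off-zero e e≢0 with nbr x s~x
      ... | d , _ , fixed , _ with d ≟ zero
      ...   | no d≢0 = ⊥-elim (proj₂ (proj₂ γ) (sym (trans (fixed zero (d≢0 ∘ sym)) x₀)))
      ...   | yes refl = sym (trans (fixed e e≢0) (x-off e e≢0))
      agree : ∀ d → s d ≡ t d
      agree d with d ≟ zero
      ... | no d≢0 = agree-off-zero d d≢0
      ... | yes refl with s zero ≟ t zero
      ...   | yes eq = eq
      ...   | no s₀≢t₀ = ⊥-elim (Adj-irrefl (nbr t (moveSmallest s₀≢t₀ agree-off-zero)))

  Agree : ℕ → S → S → Set
  Agree r s t = ∀ d → r ≤ toℕ d → s d ≡ t d

  above-other : ∀ R {e : Fin N} → toℕ R ≤ toℕ e → e ≢ R → suc (toℕ R) ≤ toℕ e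
  above-other R R≤e e≢R = ≤∧≢⇒< R≤e (e≢R ∘ sym ∘ toℕ-injective)

  settle : ℕ → Fin K → S → S
  settle r γ s d with toℕ d <? r
  ... | yes _ = γ
  ... | no _ = s d

  settle-below : ∀ r γ s d → toℕ d < r → settle r γ s d ≡ γ
  settle-below r γ s d d<r with toℕ d <? r
  ... | yes _ = refl
  ... | no d≮r = ⊥-elim (d≮r d<r)

  settle-agree : ∀ r γ s → Agree r s (settle r γ s)
  settle-agree r γ s d r≤d with toℕ d <? r
  ... | yes d<r = ⊥-elim (<-irrefl refl (<-≤-trans d<r r≤d))
  ... | no _ = refl

  -- The r-classes of s and t are distinct and joined by an edge of H_n^k,
  -- i.e. they are adjacent vertices of the contracted graph.
  record ClassAdj (r : ℕ) (s t : S) : Set where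
    constructor classAdj
    field
      distinct : ¬ Agree r s t
      s′ t′ : S
      s≈s′ : Agree r s s′
      t≈t′ : Agree r t t′
      edge : Adj s′ t′

  -- A legal move of the contracted graph: among the disks ≥ r, s and t differ
  -- exactly in disk d, and no disk between r and d is on the source or target peg.
  record ClassMove (r : ℕ) (s t : S) : Set where
    constructor classMove
    field
      disk : Fin N
      above : r ≤ toℕ disk
      moved : s disk ≢ t disk
      fixed : ∀ e → r ≤ toℕ e → e ≢ disk → s e ≡ t e
      clear : ∀ e → r ≤ toℕ e → toℕ e < toℕ disk → s e ≢ s disk × s e ≢ t disk

  -- An edge between two distinct r-classes is a move of a disk ≥ r (moves of
  -- smaller disks stay inside a class).
  classAdj⇒classMove : ∀ {r s t} → ClassAdj r s t → ClassMove r s t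
  classAdj⇒classMove {r} {s} {t} (classAdj distinct s′ t′ s≈s′ t≈t′ (d , moved , fixed , clear-s , clear-t))
    with r ≤? toℕ d
  ... | no r≰d = ⊥-elim (distinct λ e r≤e →
          trans (s≈s′ e r≤e) (trans (fixed e (λ { refl → r≰d r≤e })) (sym (t≈t′ e r≤e))))
  ... | yes r≤d = classMove d r≤d
          (λ eq → moved (trans (sym (s≈s′ d r≤d)) (trans eq (t≈t′ d r≤d))))
          (λ e r≤e e≢d → trans (s≈s′ e r≤e) (trans (fixed e e≢d) (sym (t≈t′ e r≤e))))
          (λ e r≤e e<d →
             (λ eq → clear-s e e<d (trans (sym (s≈s′ e r≤e)) (trans eq (s≈s′ d r≤d)))) ,
             (λ eq → clear-t e e<d (trans (sym (s≈s′ e r≤e)) (trans eq (t≈t′ d r≤d)))))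

  -- Changing only disk R (among the disks ≥ R) leads to an adjacent R-class:
  -- put all smaller disks on a third peg, then disk R is free to move.
  changeAt⇒classAdj : ∀ R {s t} → s R ≢ t R → (∀ e → toℕ R ≤ toℕ e → e ≢ R → s e ≡ t e) →
                      ClassAdj (toℕ R) s t
  changeAt⇒classAdj R {s} {t} s≢t fixed =
    classAdj (λ s≈t → s≢t (s≈t R R≤R)) s′ t′ (settle-agree r γ s) (settle-agree r γ t)
      (R , (λ eq → s≢t (trans (s≈s′ R R≤R) (trans eq (sym (t≈t′ R R≤R))))) ,
       fixed′ , (λ e e<R eq → γ≢s (clear s e e<R eq)) , (λ e e<R eq → γ≢t (clear t e e<R eq)))
    where
      r = toℕ R
      R≤R : r ≤ r
      R≤R = ≤-refl
      peg = thirdPeg (s R) (t R)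
      γ = proj₁ peg
      γ≢s = proj₁ (proj₂ peg)
      γ≢t = proj₂ (proj₂ peg)
      s′ = settle r γ s
      t′ = settle r γ t
      s≈s′ = settle-agree r γ s
      t≈t′ = settle-agree r γ t
      clear : ∀ v e → toℕ e < r → s′ e ≡ settle r γ v R → γ ≡ v R
      clear v e e<R eq = trans (sym (settle-below r γ s e e<R)) (trans eq (sym (settle-agree r γ v R R≤R)))
      fixed′ : ∀ e → e ≢ R → s′ e ≡ t′ e
      fixed′ e e≢R = by-height (toℕ e <? r)
        where
          by-height : Dec (toℕ e < r) → s′ e ≡ t′ e
          by-height (yes e<R) = trans (settle-below r γ s e e<R) (sym (settle-below r γ t e e<R))
          by-height (no e≮R) = trans (sym (s≈s′ e (≮⇒≥ e≮R)))
                                 (trans (fixed e (≮⇒≥ e≮R) e≢R) (t≈t′ e (≮⇒≥ e≮R)))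

  -- k-2 r-classes, pairwise adjacent and adjacent to the classes of s and t;
  -- together with the latter two they form a k-clique.
  record CommonClique (r : ℕ) (s t : S) : Set where
    constructor commonClique
    field
      member : Fin (suc k) → S
      adj-s : ∀ a → ClassAdj r (member a) s
      adj-t : ∀ a → ClassAdj r (member a) t
      pairwise : ∀ a b → a ≢ b → ClassAdj r (member a) (member b)

  Twins : ℕ → S → S → Set
  Twins r s t = ClassAdj r s t × CommonClique r s t

  -- States agreeing above R either agree from R on, or have twin R-classes:
  -- the clique consists of the classes with disk R on each of the other k-2 pegs.
  agree-or-twins : ∀ R {s t} → Agree (suc (toℕ R)) s t → Agree (toℕ R) s t ⊎ Twins (toℕ R) s t
  agree-or-twins R {s} {t} s≈t with s R ≟ t R
  ... | yes eq = inj₁ λ e R≤e → agree e R≤e (e ≟ R)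
    where
      agree : ∀ e → toℕ R ≤ toℕ e → Dec (e ≡ R) → s e ≡ t e
      agree e _ (yes refl) = eq
      agree e R≤e (no e≢R) = s≈t e (above-other R R≤e e≢R)
  ... | no s≢t = inj₂ (changeAt⇒classAdj R s≢t fixed ,
                       commonClique member
                         (λ a → changeAt⇒classAdj R (peg≢s a ∘ flip-at a) (λ e _ e≢R → off a e e≢R))
                         (λ a → changeAt⇒classAdj R (peg≢t a ∘ flip-at a)
                                  (λ e R≤e e≢R → trans (off a e e≢R) (fixed e R≤e e≢R)))
                         (λ a b a≢b → changeAt⇒classAdj R
                                  (λ eq → a≢b (peg-injective (trans (sym (at a)) (trans eq (at b)))))
                                  (λ e _ e≢R → trans (off a e e≢R) (sym (off b e e≢R)))))
    where
      fixed : ∀ e → toℕ R ≤ toℕ e → e ≢ R → s e ≡ t e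
      fixed e R≤e e≢R = s≈t e (above-other R R≤e e≢R)
      -- the k-2 pegs other than s R and t R
      peg : Fin (suc k) → Fin K
      peg a = punchIn (s R) (punchIn (punchOut s≢t) a)
      peg≢s : ∀ a → peg a ≢ s R
      peg≢s a = punchInᵢ≢i (s R) _
      peg≢t : ∀ a → peg a ≢ t R
      peg≢t a eq = punchInᵢ≢i (punchOut s≢t) a
                     (punchIn-injective (s R) _ _ (trans eq (sym (punchIn-punchOut s≢t))))
      peg-injective : Injective _≡_ _≡_ peg
      peg-injective {a} {b} = punchIn-injective (punchOut s≢t) a b ∘ punchIn-injective (s R) _ _
      member : Fin (suc k) → S
      member a = place R (peg a) s
      at : ∀ a → member a R ≡ peg a
      at a = updateAt-updates R {f = λ _ → peg a} s
      off : ∀ a e → e ≢ R → member a e ≡ s e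
      off a e e≢R = updateAt-minimal e R s e≢R
      flip-at : ∀ a {α} → member a R ≡ α → peg a ≡ α
      flip-at a eq = trans (sym (at a)) eq

  record Detour (R d : Fin N) (s t w : S) : Set where
    constructor detour
    field
      miss-R : s R ≢ w d
      miss-s : s d ≢ w d
      miss-t : t d ≢ w d
      fixed : ∀ e → toℕ R ≤ toℕ e → e ≢ d → w e ≡ s e

  commonNeighbour-detour : ∀ R {s t} (mv : ClassMove (toℕ R) s t) → toℕ R < toℕ (ClassMove.disk mv) →
    ∀ {w} → ClassMove (toℕ R) w s → ClassMove (toℕ R) w t → Detour R (ClassMove.disk mv) s t w
  commonNeighbour-detour R {s} {t} (classMove d R≤d s≢t st-fixed _) R<d {w}
    (classMove d₁ R≤d₁ w≢s ws-fixed ws-clear) (classMove d₂ R≤d₂ w≢t wt-fixed _)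
    with d₁ ≟ d
  ... | no d₁≢d = ⊥-elim (other-disk (d₂ ≟ d))
    where
      w-d : w d ≡ s d
      w-d = ws-fixed d R≤d (d₁≢d ∘ sym)
      other-disk : Dec (d₂ ≡ d) → ⊥
      other-disk (yes refl) = w≢s (trans (wt-fixed d₁ R≤d₁ d₁≢d) (sym (st-fixed d₁ R≤d₁ d₁≢d)))
      other-disk (no d₂≢d) = s≢t (trans (sym w-d) (wt-fixed d R≤d (d₂≢d ∘ sym)))
  ... | yes refl = detour miss-R (w≢s ∘ sym) (miss-t (d₂ ≟ d)) ws-fixed
    where
      R≢d : R ≢ d
      R≢d R≡d = <-irrefl (cong toℕ R≡d) R<d
      miss-R : s R ≢ w d
      miss-R eq = proj₁ (ws-clear R ≤-refl R<d)
                    (trans (ws-fixed R ≤-refl R≢d) eq)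
      miss-t : Dec (d₂ ≡ d) → t d ≢ w d
      miss-t (yes refl) = w≢t ∘ sym
      miss-t (no d₂≢d) _ = w≢t (trans (ws-fixed d₂ R≤d₂ d₂≢d) (st-fixed d₂ R≤d₂ d₂≢d))

  -- Twin R-classes differ only in disk R.  Otherwise a larger disk d moves,
  -- and the clique members put d on k-2 distinct pegs missing three (pigeonhole).
  twins⇒agree : ∀ R {s t} → Twins (toℕ R) s t → Agree (suc (toℕ R)) s t
  twins⇒agree R {s} {t} (st , commonClique member adj-s adj-t pairwise)
    with classAdj⇒classMove st
  ... | mv@(classMove d R≤d s≢t fixed clear) with m≤n⇒m<n∨m≡n R≤d
  ...   | inj₂ R≡d = λ e R<e → fixed e (<⇒≤ R<e) (λ { refl → <-irrefl R≡d R<e })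
  ...   | inj₁ R<d = ⊥-elim (noInjectionMissingThree peg-injective
                       (λ a → Detour.miss-R (shape a)) (λ a → Detour.miss-s (shape a))
                       (λ a → Detour.miss-t (shape a)) sR≢sd sR≢td s≢t)
    where
      shape : ∀ a → Detour R d s t (member a)
      shape a = commonNeighbour-detour R mv R<d (classAdj⇒classMove (adj-s a))
                                                (classAdj⇒classMove (adj-t a))
      sR≢sd = proj₁ (clear R ≤-refl R<d)
      sR≢td = proj₂ (clear R ≤-refl R<d)
      peg : Fin (suc k) → Fin K
      peg a = member a d
      peg-injective : Injective _≡_ _≡_ peg
      peg-injective {a} {b} eq with a ≟ b
      ... | yes a≡b = a≡b
      ... | no a≢b = ⊥-elim (ClassAdj.distinct (pairwise a b a≢b) agree)
        where
          agree : Agree (toℕ R) (member a) (member b)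
          agree e R≤e with e ≟ d
          ... | yes refl = eq
          ... | no e≢d = trans (Detour.fixed (shape a) e R≤e e≢d)
                               (sym (Detour.fixed (shape b) e R≤e e≢d))

  Respects : ℕ → Aut K N → Set
  Respects r g = ∀ s t → Agree r s t → Agree r (Aut.to g s) (Aut.to g t)

  -- If all automorphisms respect r-classes, they also reflect them (apply g⁻¹).
  reflects : ∀ r → (∀ g → Respects r g) → ∀ g s t → Agree r (Aut.to g s) (Aut.to g t) → Agree r s t
  reflects r resp g s t gs≈gt =
    subst₂ (Agree r) (from∘to s) (from∘to t) (resp (inverse g) _ _ gs≈gt)
    where
      from∘to = Inverse.strictlyInverseʳ (Aut.bij g)

  classAdj-preserved : ∀ r → (∀ g → Respects r g) → ∀ g {s t} →
                       ClassAdj r s t → ClassAdj r (Aut.to g s) (Aut.to g t)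
  classAdj-preserved r resp g {s} {t} (classAdj distinct s′ t′ s≈s′ t≈t′ edge) =
    classAdj (distinct ∘ reflects r resp g s t) (Aut.to g s′) (Aut.to g t′)
             (resp g s s′ s≈s′) (resp g t t′ t≈t′) (proj₁ (Aut.adj-iff g s′ t′) edge)

  twins-preserved : ∀ r → (∀ g → Respects r g) → ∀ g {s t} →
                    Twins r s t → Twins r (Aut.to g s) (Aut.to g t)
  twins-preserved r resp g (st , commonClique member adj-s adj-t pairwise) =
    preserve st ,
    commonClique (Aut.to g ∘ member) (preserve ∘ adj-s) (preserve ∘ adj-t)
                 (λ a b a≢b → preserve (pairwise a b a≢b))
    where
      preserve : ∀ {u v} → ClassAdj r u v → ClassAdj r (Aut.to g u) (Aut.to g v)
      preserve = classAdj-preserved r resp g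

  -- Base case: 0-classes are single states, and automorphisms preserve
  -- neighbourhoods, which determine states.
  respects-zero : ∀ g → Respects 0 g
  respects-zero g s t s≈t d _ = neighbourhood-determines (to s) (to t) same-nbrs d
    where
      to = Aut.to g
      from = Inverse.from (Aut.bij g)
      to∘from = Inverse.strictlyInverseˡ (Aut.bij g)
      same-nbrs : ∀ x → Adj (to s) x → Adj (to t) x
      same-nbrs x gs~x =
        subst (Adj (to t)) (to∘from x)
          (proj₁ (Aut.adj-iff g t (from x))
            (Adj-respˡ (λ e → s≈t e z≤n)
              (proj₂ (Aut.adj-iff g s (from x)) (subst (Adj (to s)) (sym (to∘from x)) gs~x))))

  -- Induction step at a disk R: (R+1)-equivalent states are R-equivalent or twins.
  respects-step : ∀ R → (∀ g → Respects (toℕ R) g) → ∀ g → Respects (suc (toℕ R)) g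
  respects-step R resp g s t s≈t with agree-or-twins R s≈t
  ... | inj₁ s≈ᵣt = λ d R<d → resp g s t s≈ᵣt d (<⇒≤ R<d)
  ... | inj₂ twins = twins⇒agree R (twins-preserved (toℕ R) resp g twins)

  respects-all : ∀ r g → Respects r g
  respects-all zero = respects-zero
  respects-all (suc r) with r <? N
  ... | no r≮N = λ g s t _ d r<d → ⊥-elim (r≮N (<-≤-trans r<d (<⇒≤ (toℕ<n d))))
  ... | yes r<N = subst (λ x → ∀ g → Respects (suc x) g) (toℕ-fromℕ< r<N)
                    (respects-step R (subst (λ x → ∀ g → Respects x g) (sym (toℕ-fromℕ< r<N))
                                      (respects-all r)))
    where
      R = fromℕ< r<N

  -- The only disk ≥ m is the largest disk m, so m-classes are the substructures [j].
  largest-disk : ∀ d → m ≤ toℕ d → d ≡ fromℕ m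
  largest-disk d m≤d = ≤-antisym (≤fromℕ d) (subst (_≤ toℕ d) (sym (toℕ-fromℕ m)) m≤d)

  substructure-agree : ∀ i v → InSub i v → Agree m v (const i)
  substructure-agree i v v∈[i] d m≤d = subst (λ e → v e ≡ i) (sym (largest-disk d m≤d)) v∈[i]

lemma6 : (k m : ℕ) → 3 ≤ k → (i : Fin k) → (g : Aut k (suc m))
    → Aut.to g (const i) ≡ const i
    → ∀ v → InSub i v → InSub i (Aut.to g v)
lemma6 (suc (suc (suc k))) m (s≤s (s≤s (s≤s _))) i g g-fixes-ī v v∈[i] =
  -- g respects the partition into substructures, and ī ∈ [i] is fixed.
  trans (respects-all m g v (const i) (substructure-agree i v v∈[i]) (fromℕ m) m≤m)
        (cong (λ s → s (fromℕ m)) g-fixes-ī)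
  where
    open Contraction k m
    m≤m : m ≤ toℕ (fromℕ m)
    m≤m = subst (m ≤_) (sym (toℕ-fromℕ m)) ≤-refl
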